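{- Let $p$ be an odd prime and let $c\in GF(p)\setminus\{0\}$ be a nonsquare if $p\equiv 1 \pmod 4$ and a nonzero square if $p\equiv 3\pmod 4$. For $k\in\{1,\dots,p-1\}$ let $O_k\subset PG(2,p)$ be the conic $x^2+ky^2+ckz^2=0$. Let $\alpha\neq\beta$ in $\{1,\dots,p-1\}$ and $n\ge 3$. If the pair $(O_\alpha,O_\beta)$ has an $n$-sided Poncelet polygon with a vertex $P\in O_\beta$, then for every point $Q\in O_\beta$ the pair $(O_\alpha,O_\beta)$ has an $n$-sided Poncelet polygon with vertex $Q$.
   Context: $PG(2,p)$ is the projective plane over $GF(p)$: points are nonzero vectors $(x,y,z)\in GF(p)^3$ up to nonzero scalar multiples, lines are nonzero vectors $(a,b,c)$ up to scalars, and a point lies on a line iff $ax+by+cz=0$. A line is a tangent of a conic if it meets it in exactly one point. For distinct indices $\alpha,\beta$, an $n$-sided Poncelet polygon for the pair $(O_\alpha,O_\beta)$ is a cyclic sequence of $n$ distinct points $B_1,\dots,B_n\in O_\beta$ such that for every $i$ the line through $B_i$ and $B_{i+1}$ (with $B_{n+1}=B_1$) is a tangent of $O_\alpha$. -}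

module Defs where

open import Data.Nat as ℕ using (ℕ; zero; suc; NonZero)
open import Data.Nat.DivMod using (_%_; m%n<n)
open import Data.Integer using (ℤ; +_; _+_; _-_; _*_)
open import Data.Integer.Divisibility using (_∣_)
open import Data.Fin using (Fin; toℕ; fromℕ<)
open import Data.Product using (_×_; _,_; Σ; ∃; ∃-syntax)
open import Relation.Binary.PropositionalEquality using (_≢_)
open import Relation.Nullary using (¬_)

-- Arithmetic in GF(p): elements of GF(p) are represented by integers,
-- with equality in GF(p) being congruence modulo p.
_≡[_]_ : ℤ → ℕ → ℤ → Set
a ≡[ p ] b = (+ p) ∣ (a - b)

IsZero : ℕ → ℤ → Set
IsZero p a = a ≡[ p ] (+ 0)

IsSquare : ℕ → ℤ → Set
IsSquare p a = ∃[ t ] ((t * t) ≡[ p ] a)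

-- Homogeneous coordinate triples (for both points and lines of PG(2,p)).
Triple : Set
Triple = ℤ × ℤ × ℤ

IsProj : ℕ → Triple → Set
IsProj p (x , y , z) = ¬ (IsZero p x × IsZero p y × IsZero p z)

SamePt : ℕ → Triple → Triple → Set
SamePt p (x , y , z) (x' , y' , z') =
  ∃[ l ] (¬ IsZero p l × ((l * x) ≡[ p ] x') × ((l * y) ≡[ p ] y') × ((l * z) ≡[ p ] z'))

OnLine : ℕ → Triple → Triple → Set
OnLine p (x , y , z) (a , b , c) = IsZero p (a * x + b * y + c * z)

OnConic : ℕ → ℤ → ℤ → Triple → Set
OnConic p c k (x , y , z) = IsZero p (x * x + k * (y * y) + (c * k) * (z * z))

IsTangent : ℕ → ℤ → ℤ → Triple → Set
IsTangent p c k L =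
  ∃[ R ] (IsProj p R × OnLine p R L × OnConic p c k R ×
          (∀ S → IsProj p S → OnLine p S L → OnConic p c k S → SamePt p S R))

-- The line through two points (cross product of coordinate vectors).
join : Triple → Triple → Triple
join (x , y , z) (x' , y' , z') =
  (y * z' - z * y' , z * x' - x * z' , x * y' - y * x')

next : ∀ {n} → Fin n → Fin n
next {suc m} i = fromℕ< (m%n<n (suc (toℕ i)) (suc m))

IsPonceletPolygon : ℕ → ℤ → ℤ → ℤ → (n : ℕ) → (Fin n → Triple) → Set
IsPonceletPolygon p c α β n B =
  (∀ i → IsProj p (B i)) ×
  (∀ i → OnConic p c β (B i)) ×
  (∀ i j → i ≢ j → ¬ SamePt p (B i) (B j)) ×
  (∀ i → IsTangent p c α (join (B i) (B (next i))))

HasPolygonWithVertex : ℕ → ℤ → ℤ → ℤ → ℕ → Triple → Set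
HasPolygonWithVertex p c α β n P =
  ∃[ B ] (IsPonceletPolygon p c α β n B × ∃[ i ] SamePt p (B i) P)

module Submission where

-- Write ω = √(-c).  The maps σ_{s,a,b}(x, y, z) = (s x, a y - c b z, b y + a z)
-- scale x by s and multiply y + zω by a + bω, so they multiply the norm form
-- N(y, z) = y² + c z² by N(a, b).  When N(a, b) = s² ≠ 0 such a map is a
-- collineation preserving every conic O_k : x² + k N(y, z) = 0 simultaneously;
-- it therefore carries Poncelet polygons of (O_α, O_β) to Poncelet polygons.
-- For points P, Q ∈ O_β with nonzero first coordinates an explicit choice of
-- (s, a, b) sends P to Q, which proves the theorem.
--
-- The number theory ensures the first coordinates are nonzero: the hypotheses
-- on c make -c a nonsquare (the quadratic character of -1 is computed from the
-- parity of the fixed points of the involution x ↦ ±x⁻¹ on {1,…,(p-1)/2}), so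
-- N is anisotropic and x = 0 forces y = z = 0 on O_β.

open import Defs
open import Data.Nat as ℕ using (ℕ; zero; suc; _≤_; _<_; _%_; NonZero; z≤n; s≤s; _≟_; _≡ᵇ_)
open import Data.Nat.Properties as ℕP using (≤-refl; ≤-pred; ≤-trans; n≤1+n; m≤n⇒m≤1+n; +-suc; <⇒≢; m<1+n⇒m<n∨m≡n; ≡ᵇ⇒≡; ≡⇒≡ᵇ)
import Data.Nat.Divisibility as ℕD
import Data.Nat.DivMod as ℕDM
import Data.Nat.Tactic.RingSolver as ℕSolver
open import Data.Nat.Primality using (Prime; prime⇒nonZero; prime⇒nonTrivial; prime⇒irreducible; euclidsLemma)
open import Data.Nat.Coprimality using (Coprime; coprime-Bézout)
open import Data.Nat.GCD using (module Bézout)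
open import Data.Integer using (ℤ; +_; -[1+_]; _+_; _-_; _*_; -_; ∣_∣)
import Data.Integer.Properties as ℤP
open import Data.Integer.Divisibility.Signed using (_∣_; _∣?_; divides; ∣ᵤ⇒∣; ∣⇒∣ᵤ; ∣m∣n⇒∣m+n; ∣n⇒∣m*n; ∣m⇒∣-m)
open import Data.Integer.DivMod using (_%ℕ_; _/ℕ_; a≡a%ℕn+[a/ℕn]*n; n%ℕd<d)
open import Data.Integer.Tactic.RingSolver using (solve-∀)
open import Data.Bool using (Bool; true; false; T; _∧_; not; if_then_else_)
open import Data.Bool.Properties using (∧-zeroʳ; ∧-identityʳ; T-∧)
open import Data.Product using (∃; ∃-syntax; _×_; _,_; proj₁; proj₂)
open import Data.Sum using (_⊎_; inj₁; inj₂; [_,_]′)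
import Data.Sum
open import Data.Empty using (⊥; ⊥-elim)
open import Function.Bundles using (Equivalence)
open import Relation.Nullary using (¬_; Dec; yes; no; contradiction)
open import Relation.Nullary.Decidable using (_×-dec_; _⊎-dec_)
open import Relation.Binary.PropositionalEquality using (_≡_; _≢_; refl; sym; trans; cong; cong₂; subst; subst₂; module ≡-Reasoning)

first : Triple → ℤ
first (x , _ , _) = x

module Residues (p : ℕ) (p-prime : Prime p) where

  instance
    p-nonZero : NonZero p
    p-nonZero = prime⇒nonZero p-prime

  open ≡-Reasoning

  Zero : ℤ → Set
  Zero a = (+ p) ∣ a

  zero? : ∀ a → Dec (Zero a)
  zero? a = (+ p) ∣? a

  zero-0 : Zero (+ 0)
  zero-0 = divides (+ 0) refl

  zero-p : Zero (+ p)
  zero-p = divides (+ 1) (sym (ℤP.*-identityˡ (+ p)))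

  -- The vanishing integers form an ideal; every use of it is an explicit
  -- ring identity exhibiting a as a combination of known zeros.
  combination₁ : ∀ {a} u d → a ≡ u * d → Zero d → Zero a
  combination₁ u d refl zd = ∣n⇒∣m*n u zd

  combination₂ : ∀ {a} u d v e → a ≡ u * d + v * e → Zero d → Zero e → Zero a
  combination₂ u d v e refl zd ze = ∣m∣n⇒∣m+n (∣n⇒∣m*n u zd) (∣n⇒∣m*n v ze)

  fromIsZero : ∀ {a} → IsZero p a → Zero a
  fromIsZero {a} z = subst Zero (ℤP.+-identityʳ a) (∣ᵤ⇒∣ z)

  toIsZero : ∀ {a} → Zero a → IsZero p a
  toIsZero {a} z = ∣⇒∣ᵤ (subst Zero (sym (ℤP.+-identityʳ a)) z)

  fromCong : ∀ a b → a ≡[ p ] b → Zero (a - b)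
  fromCong a b = ∣ᵤ⇒∣

  toCong : ∀ a b → Zero (a - b) → a ≡[ p ] b
  toCong a b = ∣⇒∣ᵤ

  euclid : ∀ a b → Zero (a * b) → Zero a ⊎ Zero b
  euclid a b z = Data.Sum.map ∣ᵤ⇒∣ ∣ᵤ⇒∣ (euclidsLemma ∣ a ∣ ∣ b ∣ p-prime (subst (p ℕD.∣_) (ℤP.abs-* a b) (∣⇒∣ᵤ z)))

  nonzero-* : ∀ {a b} → ¬ Zero a → ¬ Zero b → ¬ Zero (a * b)
  nonzero-* {a} {b} na nb z = [ na , nb ]′ (euclid a b z)

  cancelˡ : ∀ {a b} → ¬ Zero a → Zero (a * b) → Zero b
  cancelˡ {a} {b} na z = [ (λ za → ⊥-elim (na za)) , (λ zb → zb) ]′ (euclid a b z)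

  square-zero : ∀ a → Zero (a * a) → Zero a
  square-zero a z = [ (λ za → za) , (λ za → za) ]′ (euclid a a z)

  small-zero : ∀ a → ∣ a ∣ < p → Zero a → a ≡ + 0
  small-zero a ∣a∣<p z = ℤP.∣i∣≡0⇒i≡0 (below-p ∣ a ∣ ∣a∣<p (∣⇒∣ᵤ z))
    where
    below-p : ∀ n → n < p → p ℕD.∣ n → n ≡ 0
    below-p zero _ _ = refl
    below-p (suc n) n<p p∣n = contradiction (ℕD.∣⇒≤ p∣n) (ℕP.<⇒≱ n<p)

  small-nonzero : ∀ n → 0 < n → n < p → ¬ Zero (+ n)
  small-nonzero (suc n) _ n<p z with small-zero (+ suc n) n<p z
  ... | ()

  one-nonzero : ¬ Zero (+ 1)
  one-nonzero = small-nonzero 1 (s≤s z≤n) (ℕ.nonTrivial⇒n>1 p {{prime⇒nonTrivial p-prime}})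

  -- Every nonzero residue is invertible: Bézout for the coprime pair p, ∣a∣.
  private
    coprime-to-p : ∀ {n} → ¬ (p ℕD.∣ n) → Coprime p n
    coprime-to-p p∤n (d∣p , d∣n) with prime⇒irreducible p-prime d∣p
    ... | inj₁ d≡1 = d≡1
    ... | inj₂ refl = contradiction d∣n p∤n

    cast : ∀ a b c d → 1 ℕ.+ a ℕ.* b ≡ c ℕ.* d → + 1 + + a * + b ≡ + c * + d
    cast a b c d eq = begin
      + 1 + + a * + b    ≡⟨ cong (_+_ (+ 1)) (ℤP.pos-* a b) ⟨
      + (1 ℕ.+ a ℕ.* b)  ≡⟨ cong +_ eq ⟩
      + (c ℕ.* d)        ≡⟨ ℤP.pos-* c d ⟩
      + c * + d          ∎

    negate-sum : ∀ y n → (- y) * n - + 1 ≡ - (+ 1 + y * n)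
    negate-sum = solve-∀

    drop-one : ∀ x p → (+ 1 + x * p) - + 1 ≡ x * p
    drop-one = solve-∀

    inverse-ℕ : ∀ n → ¬ Zero (+ n) → ∃[ u ] Zero (u * + n - + 1)
    inverse-ℕ n nz with coprime-Bézout (coprime-to-p (λ p∣n → nz (∣ᵤ⇒∣ p∣n)))
    ... | Bézout.+- x y eq = (- + y) , combination₁ (- + x) (+ p) identity zero-p
      where
      identity : (- + y) * + n - + 1 ≡ (- + x) * + p
      identity = begin
        (- + y) * + n - + 1   ≡⟨ negate-sum (+ y) (+ n) ⟩
        - (+ 1 + + y * + n)   ≡⟨ cong -_ (cast y n x p eq) ⟩
        - (+ x * + p)         ≡⟨ ℤP.neg-distribˡ-* (+ x) (+ p) ⟩
        (- + x) * + p         ∎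
    ... | Bézout.-+ x y eq = (+ y) , combination₁ (+ x) (+ p) identity zero-p
      where
      identity : + y * + n - + 1 ≡ + x * + p
      identity = begin
        + y * + n - + 1           ≡⟨ cong (_- + 1) (cast x p y n eq) ⟨
        (+ 1 + + x * + p) - + 1   ≡⟨ drop-one (+ x) (+ p) ⟩
        + x * + p                 ∎

    negate-both : ∀ u x → (- u) * (- x) - + 1 ≡ u * x - + 1
    negate-both = solve-∀

  inverse : ∀ a → ¬ Zero a → ∃[ u ] Zero (u * a - + 1)
  inverse (+ n) na = inverse-ℕ n na
  inverse -[1+ n ] na with inverse-ℕ (suc n) (λ z → na (∣m⇒∣-m z))
  ... | u , z = (- u) , subst Zero (sym (negate-both u (+ suc n))) z

  invertible-nonzero : ∀ {u a} → Zero (u * a - + 1) → ¬ Zero u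
  invertible-nonzero {u} {a} inv zu = one-nonzero (combination₂ a u (- + 1) (u * a - + 1) (one-as u a) zu inv)
    where
    one-as : ∀ u a → + 1 ≡ a * u + (- + 1) * (u * a - + 1)
    one-as = solve-∀

  ¬IsZero⇒¬Zero : ∀ a → ¬ IsZero p a → ¬ Zero a
  ¬IsZero⇒¬Zero a na z = na (toIsZero z)

  ¬Zero⇒¬IsZero : ∀ a → ¬ Zero a → ¬ IsZero p a
  ¬Zero⇒¬IsZero a na z = na (fromIsZero z)

  AllZero : Triple → Set
  AllZero (x , y , z) = Zero x × Zero y × Zero z

  IsProj⇒¬AllZero : ∀ {T} → IsProj p T → ¬ AllZero T
  IsProj⇒¬AllZero pr (zx , zy , zz) = pr (toIsZero zx , toIsZero zy , toIsZero zz)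

  ¬AllZero⇒IsProj : ∀ {T} → ¬ AllZero T → IsProj p T
  ¬AllZero⇒IsProj nz (zx , zy , zz) = nz (fromIsZero zx , fromIsZero zy , fromIsZero zz)

  scale : ℤ → Triple → Triple
  scale l (x , y , z) = (l * x , l * y , l * z)

  private
    symmetric-coordinate : ∀ u l x x' → Zero (u * l - + 1) → Zero (l * x - x') → Zero (u * x' - x)
    symmetric-coordinate u l x x' inv e = combination₂ (- u) (l * x - x') x (u * l - + 1) (identity u l x x') e inv
      where
      identity : ∀ u l x x' → u * x' - x ≡ (- u) * (l * x - x') + x * (u * l - + 1)
      identity = solve-∀

    transitive-coordinate : ∀ l m x x' x'' → Zero (l * x - x') → Zero (m * x' - x'') → Zero ((m * l) * x - x'')
    transitive-coordinate l m x x' x'' e e' = combination₂ m (l * x - x') (+ 1) (m * x' - x'') (identity l m x x' x'') e e'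
      where
      identity : ∀ l m x x' x'' → (m * l) * x - x'' ≡ m * (l * x - x') + (+ 1) * (m * x' - x'')
      identity = solve-∀

    reflexive-coordinate : ∀ a → a ≡[ p ] a
    reflexive-coordinate a = toCong a a (subst Zero (sym (ℤP.+-inverseʳ a)) zero-0)

  samePt-sym : ∀ T T' → SamePt p T T' → SamePt p T' T
  samePt-sym (x , y , z) (x' , y' , z') (l , nl , ex , ey , ez) with inverse l (¬IsZero⇒¬Zero l nl)
  ... | u , inv = u , ¬Zero⇒¬IsZero u (invertible-nonzero inv) ,
    toCong (u * x') x (symmetric-coordinate u l x x' inv (fromCong (l * x) x' ex)) ,
    toCong (u * y') y (symmetric-coordinate u l y y' inv (fromCong (l * y) y' ey)) ,
    toCong (u * z') z (symmetric-coordinate u l z z' inv (fromCong (l * z) z' ez))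

  samePt-trans : ∀ T T' T'' → SamePt p T T' → SamePt p T' T'' → SamePt p T T''
  samePt-trans (x , y , z) (x' , y' , z') (x'' , y'' , z'') (l , nl , ex , ey , ez) (m , nm , ex' , ey' , ez') =
    m * l , ¬Zero⇒¬IsZero (m * l) (nonzero-* (¬IsZero⇒¬Zero m nm) (¬IsZero⇒¬Zero l nl)) ,
    toCong ((m * l) * x) x'' (transitive-coordinate l m x x' x'' (fromCong (l * x) x' ex) (fromCong (m * x') x'' ex')) ,
    toCong ((m * l) * y) y'' (transitive-coordinate l m y y' y'' (fromCong (l * y) y' ey) (fromCong (m * y') y'' ey')) ,
    toCong ((m * l) * z) z'' (transitive-coordinate l m z z' z'' (fromCong (l * z) z' ez) (fromCong (m * z') z'' ez'))

  samePt-scale : ∀ l T → ¬ Zero l → SamePt p T (scale l T)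
  samePt-scale l (x , y , z) nl =
    l , ¬Zero⇒¬IsZero l nl , reflexive-coordinate (l * x) , reflexive-coordinate (l * y) , reflexive-coordinate (l * z)

-- Writing
-- ω = √(-c), the map σ s a b scales x by s and multiplies y + zω by
-- a + bω; it multiplies the norm form y² + c z² by N(a + bω), so every
-- conic x² + k(y² + c z²) = 0 is preserved as soon as N(a + bω) = s².
module Similarity (p : ℕ) (p-prime : Prime p) (c : ℤ) where
  open Residues p p-prime

  σ : ℤ → ℤ → ℤ → Triple → Triple
  σ s a b (x , y , z) = (s * x , a * y - c * b * z , b * y + a * z)

  norm : ℤ → ℤ → ℤ
  norm y z = y * y + c * (z * z)

  record Admissible (s a b : ℤ) : Set where
    constructor admissible
    field
      scalar-nonzero : ¬ Zero s
      norm-is-square : Zero (norm a b - s * s)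

  -- Parameters of the inverse map: s' = N(a + bω) and a' + b'ω = s(a - bω).
  inv-s inv-a inv-b : ℤ → ℤ → ℤ → ℤ
  inv-s s a b = norm a b
  inv-a s a b = s * a
  inv-b s a b = - (s * b)

  σ⁻¹ : ℤ → ℤ → ℤ → Triple → Triple
  σ⁻¹ s a b = σ (inv-s s a b) (inv-a s a b) (inv-b s a b)

  det : ℤ → ℤ → ℤ → ℤ
  det s a b = s * norm a b

  private
    triple-≡ : ∀ {x y z x' y' z' : ℤ} → x ≡ x' → y ≡ y' → z ≡ z' → (x , y , z) ≡ (x' , y' , z')
    triple-≡ refl refl refl = refl

  σ⁻¹∘σ : ∀ s a b T → σ⁻¹ s a b (σ s a b T) ≡ scale (det s a b) T
  σ⁻¹∘σ s a b (x , y , z) = triple-≡ (on-x s a b c x) (on-y s a b c y z) (on-z s a b c y z)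
    where
    on-x : ∀ s a b c x → (a * a + c * (b * b)) * (s * x) ≡ (s * (a * a + c * (b * b))) * x
    on-x = solve-∀
    on-y : ∀ s a b c y z → (s * a) * (a * y - c * b * z) - c * (- (s * b)) * (b * y + a * z) ≡ (s * (a * a + c * (b * b))) * y
    on-y = solve-∀
    on-z : ∀ s a b c y z → (- (s * b)) * (a * y - c * b * z) + (s * a) * (b * y + a * z) ≡ (s * (a * a + c * (b * b))) * z
    on-z = solve-∀

  σ∘σ⁻¹ : ∀ s a b T → σ s a b (σ⁻¹ s a b T) ≡ scale (det s a b) T
  σ∘σ⁻¹ s a b (x , y , z) = triple-≡ (on-x s a b c x) (on-y s a b c y z) (on-z s a b c y z)
    where
    on-x : ∀ s a b c x → s * ((a * a + c * (b * b)) * x) ≡ (s * (a * a + c * (b * b))) * x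
    on-x = solve-∀
    on-y : ∀ s a b c y z → a * ((s * a) * y - c * (- (s * b)) * z) - c * b * ((- (s * b)) * y + (s * a) * z) ≡ (s * (a * a + c * (b * b))) * y
    on-y = solve-∀
    on-z : ∀ s a b c y z → b * ((s * a) * y - c * (- (s * b)) * z) + a * ((- (s * b)) * y + (s * a) * z) ≡ (s * (a * a + c * (b * b))) * z
    on-z = solve-∀

  norm-nonzero : ∀ {s a b} → Admissible s a b → ¬ Zero (norm a b)
  norm-nonzero {s} {a} {b} (admissible ns ad) zn =
    ns (square-zero s (combination₂ (+ 1) (norm a b) (- + 1) (norm a b - s * s) (identity (norm a b) (s * s)) zn ad))
    where
    identity : ∀ n q → q ≡ (+ 1) * n + (- + 1) * (n - q)
    identity = solve-∀

  det-nonzero : ∀ {s a b} → Admissible s a b → ¬ Zero (det s a b)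
  det-nonzero adm = nonzero-* (Admissible.scalar-nonzero adm) (norm-nonzero adm)

  inverse-admissible : ∀ {s a b} → Admissible s a b → Admissible (inv-s s a b) (inv-a s a b) (inv-b s a b)
  inverse-admissible {s} {a} {b} adm =
    admissible (norm-nonzero adm) (combination₁ (- norm a b) (norm a b - s * s) (identity s a b c) (Admissible.norm-is-square adm))
    where
    identity : ∀ s a b c → ((s * a) * (s * a) + c * ((- (s * b)) * (- (s * b)))) - (a * a + c * (b * b)) * (a * a + c * (b * b))
                           ≡ (- (a * a + c * (b * b))) * ((a * a + c * (b * b)) - s * s)
    identity = solve-∀

  σ-allZero : ∀ s a b T → AllZero T → AllZero (σ s a b T)
  σ-allZero s a b (x , y , z) (zx , zy , zz) =
    combination₁ s x refl zx ,
    combination₂ a y (- (c * b)) z (on-y a b c y z) zy zz ,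
    combination₂ b y a z refl zy zz
    where
    on-y : ∀ a b c y z → a * y - c * b * z ≡ a * y + (- (c * b)) * z
    on-y = solve-∀

  σ-samePt : ∀ s a b T T' → SamePt p T T' → SamePt p (σ s a b T) (σ s a b T')
  σ-samePt s a b (x , y , z) (x' , y' , z') (l , nl , ex , ey , ez) =
    l , nl ,
    toCong (l * (s * x)) (s * x') (combination₁ s (l * x - x') (on-x s l x x') dx) ,
    toCong (l * (a * y - c * b * z)) (a * y' - c * b * z')
      (combination₂ a (l * y - y') (- (c * b)) (l * z - z') (on-y a b c l y z y' z') dy dz) ,
    toCong (l * (b * y + a * z)) (b * y' + a * z')
      (combination₂ b (l * y - y') a (l * z - z') (on-z a b l y z y' z') dy dz)
    where
    dx = fromCong (l * x) x' ex
    dy = fromCong (l * y) y' ey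
    dz = fromCong (l * z) z' ez
    on-x : ∀ s l x x' → l * (s * x) - s * x' ≡ s * (l * x - x')
    on-x = solve-∀
    on-y : ∀ a b c l y z y' z' → l * (a * y - c * b * z) - (a * y' - c * b * z') ≡ a * (l * y - y') + (- (c * b)) * (l * z - z')
    on-y = solve-∀
    on-z : ∀ a b l y z y' z' → l * (b * y + a * z) - (b * y' + a * z') ≡ b * (l * y - y') + a * (l * z - z')
    on-z = solve-∀

  -- σ multiplies x² + k(y² + c z²) by s², up to a multiple of N(a + bω) - s².
  σ-conic : ∀ {s a b} k T → Admissible s a b → OnConic p c k T → OnConic p c k (σ s a b T)
  σ-conic {s} {a} {b} k (x , y , z) (admissible _ ad) on =
    toIsZero (combination₂ (s * s) _ (k * norm y z) (norm a b - s * s) (identity s a b c k x y z) (fromIsZero on) ad)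
    where
    identity : ∀ s a b c k x y z →
      (s * x) * (s * x) + k * ((a * y - c * b * z) * (a * y - c * b * z)) + (c * k) * ((b * y + a * z) * (b * y + a * z))
      ≡ (s * s) * (x * x + k * (y * y) + (c * k) * (z * z)) + (k * (y * y + c * (z * z))) * ((a * a + c * (b * b)) - s * s)
    identity = solve-∀

  -- σ maps the line through T, T' to the line through σT, σT' (its determinant is det).
  σ-incidence : ∀ s a b T T' R → OnLine p R (join T T') → OnLine p (σ s a b R) (join (σ s a b T) (σ s a b T'))
  σ-incidence s a b (x , y , z) (x' , y' , z') (r₁ , r₂ , r₃) on =
    toIsZero (combination₁ (det s a b) _ (identity s a b c x y z x' y' z' r₁ r₂ r₃) (fromIsZero on))
    where
    identity : ∀ s a b c x y z x' y' z' r₁ r₂ r₃ →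
      ((a * y - c * b * z) * (b * y' + a * z') - (b * y + a * z) * (a * y' - c * b * z')) * (s * r₁)
      + ((b * y + a * z) * (s * x') - (s * x) * (b * y' + a * z')) * (a * r₂ - c * b * r₃)
      + ((s * x) * (a * y' - c * b * z') - (a * y - c * b * z) * (s * x')) * (b * r₂ + a * r₃)
      ≡ (s * (a * a + c * (b * b))) * ((y * z' - z * y') * r₁ + (z * x' - x * z') * r₂ + (x * y' - y * x') * r₃)
    identity = solve-∀

  allZero-unscale : ∀ {d} T → ¬ Zero d → AllZero (scale d T) → AllZero T
  allZero-unscale (x , y , z) nd (zx , zy , zz) = cancelˡ nd zx , cancelˡ nd zy , cancelˡ nd zz

  join-scale : ∀ d T T' → join (scale d T) (scale d T') ≡ scale (d * d) (join T T')
  join-scale d (x , y , z) (x' , y' , z') = triple-≡ (minor d y z y' z') (minor d z x z' x') (minor d x y x' y')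
    where
    minor : ∀ d u v u' v' → (d * u) * (d * v') - (d * v) * (d * u') ≡ (d * d) * (u * v' - v * u')
    minor = solve-∀

  incidence-unscale : ∀ {m} R L → ¬ Zero m → OnLine p R (scale m L) → OnLine p R L
  incidence-unscale {m} (x , y , z) (l₁ , l₂ , l₃) nm on =
    toIsZero (cancelˡ nm (subst Zero (pull-out m l₁ l₂ l₃ x y z) (fromIsZero on)))
    where
    pull-out : ∀ m l₁ l₂ l₃ x y z → (m * l₁) * x + (m * l₂) * y + (m * l₃) * z ≡ m * (l₁ * x + l₂ * y + l₃ * z)
    pull-out = solve-∀

  σ-proj : ∀ {s a b} T → Admissible s a b → IsProj p T → IsProj p (σ s a b T)
  σ-proj {s} {a} {b} T adm pr = ¬AllZero⇒IsProj λ z →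
    IsProj⇒¬AllZero pr (allZero-unscale T (det-nonzero adm)
      (subst AllZero (σ⁻¹∘σ s a b T) (σ-allZero (inv-s s a b) (inv-a s a b) (inv-b s a b) (σ s a b T) z)))

  σ-reflects-samePt : ∀ {s a b} T T' → Admissible s a b → SamePt p (σ s a b T) (σ s a b T') → SamePt p T T'
  σ-reflects-samePt {s} {a} {b} T T' adm same =
    samePt-trans T (scale d T) T' (samePt-scale d T (det-nonzero adm))
      (samePt-trans (scale d T) (scale d T') T' scaled (samePt-sym T' (scale d T') (samePt-scale d T' (det-nonzero adm))))
    where
    d = det s a b
    scaled : SamePt p (scale d T) (scale d T')
    scaled = subst₂ (SamePt p) (σ⁻¹∘σ s a b T) (σ⁻¹∘σ s a b T')
               (σ-samePt (inv-s s a b) (inv-a s a b) (inv-b s a b) (σ s a b T) (σ s a b T') same)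

  σ-tangent : ∀ {s a b} k T T' → Admissible s a b → IsTangent p c k (join T T') → IsTangent p c k (join (σ s a b T) (σ s a b T'))
  σ-tangent {s} {a} {b} k T T' adm (R , prR , onR , conR , unique) =
    σ s a b R , σ-proj R adm prR , σ-incidence s a b T T' R onR , σ-conic k R adm conR , only
    where
    d = det s a b
    adm⁻¹ = inverse-admissible adm
    -- A point S of the image tangent comes from the point σ⁻¹ S of the original one.
    pulled-back : ∀ S → OnLine p S (join (σ s a b T) (σ s a b T')) → OnLine p (σ⁻¹ s a b S) (join T T')
    pulled-back S on = incidence-unscale (σ⁻¹ s a b S) (join T T') (nonzero-* (det-nonzero adm) (det-nonzero adm))
      (subst (OnLine p (σ⁻¹ s a b S)) (trans (cong₂ join (σ⁻¹∘σ s a b T) (σ⁻¹∘σ s a b T')) (join-scale d T T'))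
        (σ-incidence (inv-s s a b) (inv-a s a b) (inv-b s a b) (σ s a b T) (σ s a b T') S on))
    only : ∀ S → IsProj p S → OnLine p S (join (σ s a b T) (σ s a b T')) → OnConic p c k S → SamePt p S (σ s a b R)
    only S prS onS conS =
      samePt-trans S (scale d S) (σ s a b R) (samePt-scale d S (det-nonzero adm))
        (subst (λ U → SamePt p U (σ s a b R)) (σ∘σ⁻¹ s a b S)
          (σ-samePt s a b (σ⁻¹ s a b S) R
            (unique (σ⁻¹ s a b S) (σ-proj S adm⁻¹ prS) (pulled-back S onS) (σ-conic k S adm⁻¹ conS))))

  σ-polygon : ∀ {s a b} α β n B → Admissible s a b → IsPonceletPolygon p c α β n B →
              IsPonceletPolygon p c α β n (λ i → σ s a b (B i))
  σ-polygon α β n B adm (proj , on , distinct , tangent) =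
    (λ i → σ-proj (B i) adm (proj i)) ,
    (λ i → σ-conic β (B i) adm (on i)) ,
    (λ i j i≢j same → distinct i j i≢j (σ-reflects-samePt (B i) (B j) adm same)) ,
    (λ i → σ-tangent α (B i) (B (next i)) adm (tangent i))


  -- The admissible maps act transitively on O_k away from x = 0: for
  -- P = (x, y, z) and Q = (x', y', z') take s = x x' and
  -- a + bω = -k (y' + z'ω)(y - zω); then N(a, b) - s² is a combination of
  -- the conic equations of P and Q, and σ s a b P = x² Q modulo them.
  σ-transitive : ∀ k P Q → ¬ Zero (first P) → ¬ Zero (first Q) → OnConic p c k P → OnConic p c k Q →
                 ∃[ s ] ∃[ a ] ∃[ b ] (Admissible s a b × SamePt p (σ s a b P) Q)
  σ-transitive k (x , y , z) (x' , y' , z') nx nx' onP onQ =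
    s , a , b , admissible (nonzero-* nx nx') norm-square ,
    samePt-sym (x' , y' , z') (σ s a b (x , y , z)) (x * x , ¬Zero⇒¬IsZero (x * x) (nonzero-* nx nx) ,
      toCong ((x * x) * x') (s * x) (combination₁ (+ 0) E (coordinate₁ x x' E) zE) ,
      toCong ((x * x) * y') (a * y - c * b * z) (combination₁ y' E (coordinate₂ x y z y' z' c k) zE) ,
      toCong ((x * x) * z') (b * y + a * z) (combination₁ z' E (coordinate₃ x y z y' z' c k) zE))
    where
    s = x * x'
    a = - k * (y' * y + c * (z' * z))
    b = - k * (z' * y - y' * z)
    E = x * x + k * (y * y) + (c * k) * (z * z)
    E' = x' * x' + k * (y' * y') + (c * k) * (z' * z')
    zE : Zero E
    zE = fromIsZero onP
    norm-product : ∀ x y z x' y' z' c k →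
      (- k * (y' * y + c * (z' * z))) * (- k * (y' * y + c * (z' * z))) + c * ((- k * (z' * y - y' * z)) * (- k * (z' * y - y' * z))) - (x * x') * (x * x')
      ≡ (k * (y' * y' + c * (z' * z'))) * (x * x + k * (y * y) + (c * k) * (z * z)) + (- (x * x)) * (x' * x' + k * (y' * y') + (c * k) * (z' * z'))
    norm-product = solve-∀
    norm-square : Zero (norm a b - s * s)
    norm-square = combination₂ (k * (y' * y' + c * (z' * z'))) E (- (x * x)) E' (norm-product x y z x' y' z' c k) zE (fromIsZero onQ)
    coordinate₁ : ∀ x x' E → (x * x) * x' - (x * x') * x ≡ (+ 0) * E
    coordinate₁ = solve-∀
    coordinate₂ : ∀ x y z y' z' c k →
      (x * x) * y' - ((- k * (y' * y + c * (z' * z))) * y - c * (- k * (z' * y - y' * z)) * z) ≡ y' * (x * x + k * (y * y) + (c * k) * (z * z))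
    coordinate₂ = solve-∀
    coordinate₃ : ∀ x y z y' z' c k →
      (x * x) * z' - ((- k * (z' * y - y' * z)) * y + (- k * (y' * y + c * (z' * z))) * z) ≡ z' * (x * x + k * (y * y) + (c * k) * (z * z))
    coordinate₃ = solve-∀

module FixedPointParity where

  -- Subsets of ℕ by characteristic function; only {0,…,N-1} is counted.
  Subset : Set
  Subset = ℕ → Bool

  indicator : Bool → ℕ
  indicator b = if b then 1 else 0

  count : Subset → ℕ → ℕ
  count P zero = 0
  count P (suc N) = indicator (P N) ℕ.+ count P N

  Even : ℕ → Set
  Even n = ∃[ j ] n ≡ j ℕ.+ j

  remove : ℕ → Subset → Subset
  remove a P x = P x ∧ not (x ≡ᵇ a)

  FixedBy : (ℕ → ℕ) → Subset → Subset
  FixedBy f P x = P x ∧ (f x ≡ᵇ x)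

  remove-self : ∀ a P → remove a P a ≡ false
  remove-self a P with a ≡ᵇ a in eq
  ... | true = ∧-zeroʳ (P a)
  ... | false = contradiction (subst T eq (≡⇒≡ᵇ a a refl)) λ ()

  remove-other : ∀ a P x → x ≢ a → remove a P x ≡ P x
  remove-other a P x x≢a with x ≡ᵇ a in eq
  ... | true = contradiction (≡ᵇ⇒≡ x a (subst T (sym eq) _)) x≢a
  ... | false = ∧-identityʳ (P x)

  private
    T-true : ∀ {b} → T b → b ≡ true
    T-true {true} _ = refl

    weaken : ∀ {x N} → x < N → x < suc N
    weaken = m≤n⇒m≤1+n

  count-ext : ∀ P Q N → (∀ x → x < N → P x ≡ Q x) → count P N ≡ count Q N
  count-ext P Q zero _ = refl
  count-ext P Q (suc N) eq = cong₂ ℕ._+_ (cong indicator (eq N ≤-refl)) (count-ext P Q N (λ x x<N → eq x (weaken x<N)))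

  count-empty : ∀ P N → (∀ x → x < N → ¬ T (P x)) → count P N ≡ 0
  count-empty P zero _ = refl
  count-empty P (suc N) empty with P N in eq
  ... | true = contradiction (subst T (sym eq) _) (empty N ≤-refl)
  ... | false = count-empty P N (λ x x<N → empty x (weaken x<N))

  count-remove : ∀ a P N → a < N → T (P a) → count P N ≡ suc (count (remove a P) N)
  count-remove a P (suc N) a<1+N Pa with m<1+n⇒m<n∨m≡n a<1+N
  ... | inj₂ refl = begin
    indicator (P a) ℕ.+ count P a                  ≡⟨ cong (λ b → indicator b ℕ.+ count P a) (T-true Pa) ⟩
    suc (count P a)                              ≡⟨ cong suc (count-ext P (remove a P) a (λ x x<a → sym (remove-other a P x (<⇒≢ x<a)))) ⟩
    suc (count (remove a P) a)                   ≡⟨ cong (λ b → suc (indicator b ℕ.+ count (remove a P) a)) (remove-self a P) ⟨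
    suc (indicator (remove a P a) ℕ.+ count (remove a P) a) ∎
    where open ≡-Reasoning
  ... | inj₁ a<N = begin
    indicator (P N) ℕ.+ count P N                          ≡⟨ cong (indicator (P N) ℕ.+_) (count-remove a P N a<N Pa) ⟩
    indicator (P N) ℕ.+ suc (count (remove a P) N)         ≡⟨ +-suc (indicator (P N)) _ ⟩
    suc (indicator (P N) ℕ.+ count (remove a P) N)         ≡⟨ cong (λ b → suc (indicator b ℕ.+ count (remove a P) N)) (remove-other a P N (λ N≡a → <⇒≢ a<N (sym N≡a))) ⟨
    suc (indicator (remove a P N) ℕ.+ count (remove a P) N) ∎
    where open ≡-Reasoning

  empty-or-member : (P : Subset) (N : ℕ) → (∀ x → x < N → ¬ T (P x)) ⊎ ∃[ a ] (a < N × T (P a))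
  empty-or-member P zero = inj₁ (λ x ())
  empty-or-member P (suc N) with P N in eq
  ... | true = inj₂ (N , ≤-refl , subst T (sym eq) _)
  ... | false with empty-or-member P N
  ...   | inj₂ (a , a<N , Pa) = inj₂ (a , weaken a<N , Pa)
  ...   | inj₁ empty = inj₁ λ x x<1+N → [ empty x , (λ { refl → subst T eq }) ]′ (m<1+n⇒m<n∨m≡n x<1+N)

  member-remove : ∀ a P x → T (remove a P x) → T (P x) × x ≢ a
  member-remove a P x t = subst T (remove-other a P x x≢a) t , x≢a
    where
    x≢a : x ≢ a
    x≢a refl = subst T (remove-self a P) t

  remove-member : ∀ a P x → T (P x) → x ≢ a → T (remove a P x)
  remove-member a P x t x≢a = subst T (sym (remove-other a P x x≢a)) t

  remove-nonmember : ∀ a P x → P a ≡ false → remove a P x ≡ P x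
  remove-nonmember a P x Pa≡false with x ≟ a
  ... | yes refl = trans (remove-self a P) (sym Pa≡false)
  ... | no x≢a = remove-other a P x x≢a

  FixedBy-remove : ∀ f a P x → FixedBy f (remove a P) x ≡ remove a (FixedBy f P) x
  FixedBy-remove f a P x with x ≟ a
  ... | yes refl = trans (cong (_∧ (f x ≡ᵇ x)) (remove-self a P)) (sym (remove-self a (FixedBy f P)))
  ... | no x≢a = trans (cong (_∧ (f x ≡ᵇ x)) (remove-other a P x x≢a)) (sym (remove-other a (FixedBy f P) x x≢a))

  nonfixed : ∀ f P a → f a ≢ a → FixedBy f P a ≡ false
  nonfixed f P a fa≢a with f a ≡ᵇ a in eq
  ... | true = contradiction (≡ᵇ⇒≡ (f a) a (subst T (sym eq) _)) fa≢a
  ... | false = ∧-zeroʳ (P a)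

  fixed-member : ∀ f P a → T (P a) → f a ≡ a → T (FixedBy f P a)
  fixed-member f P a Pa fa≡a rewrite fa≡a = Equivalence.from T-∧ (Pa , ≡⇒≡ᵇ a a refl)

  FixedBy-remove-nonfixed : ∀ f a P x → f a ≢ a → FixedBy f (remove a P) x ≡ FixedBy f P x
  FixedBy-remove-nonfixed f a P x fa≢a = trans (FixedBy-remove f a P x) (remove-nonmember a (FixedBy f P) x (nonfixed f P a fa≢a))

  record InvolutionOn (N : ℕ) (f : ℕ → ℕ) (P : Subset) : Set where
    field
      bounded : ∀ x → x < N → T (P x) → f x < N
      closed : ∀ x → x < N → T (P x) → T (P (f x))
      involutive : ∀ x → x < N → T (P x) → f (f x) ≡ x

  restrict-fixed : ∀ {N f P a} → InvolutionOn N f P → f a ≡ a → InvolutionOn N f (remove a P)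
  restrict-fixed {N} {f} {P} {a} inv fa≡a = record
    { bounded = λ x x<N t → bounded x x<N (proj₁ (member-remove a P x t))
    ; closed = λ x x<N t → let (Px , x≢a) = member-remove a P x t in
        remove-member a P (f x) (closed x x<N Px) (λ fx≡a → x≢a (trans (sym (involutive x x<N Px)) (trans (cong f fx≡a) fa≡a)))
    ; involutive = λ x x<N t → involutive x x<N (proj₁ (member-remove a P x t))
    }
    where open InvolutionOn inv

  restrict-pair : ∀ {N f P a} → InvolutionOn N f P → a < N → T (P a) → InvolutionOn N f (remove (f a) (remove a P))
  restrict-pair {N} {f} {P} {a} inv a<N Pa = record
    { bounded = λ x x<N t → bounded x x<N (member x t .proj₁)
    ; closed = λ x x<N t → let (Px , x≢a , x≢fa) = member x t in
        remove-member (f a) (remove a P) (f x) (remove-member a P (f x) (closed x x<N Px)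
          (λ fx≡a → x≢fa (trans (sym (involutive x x<N Px)) (cong f fx≡a))))
          (λ fx≡fa → x≢a (trans (sym (involutive x x<N Px)) (trans (cong f fx≡fa) (involutive a a<N Pa))))
    ; involutive = λ x x<N t → involutive x x<N (member x t .proj₁)
    }
    where
    open InvolutionOn inv
    member : ∀ x → T (remove (f a) (remove a P) x) → T (P x) × x ≢ a × x ≢ f a
    member x t = let (t' , x≢fa) = member-remove (f a) (remove a P) x t ; (Px , x≢a) = member-remove a P x t' in Px , x≢a , x≢fa

  private
    even-step₁ : ∀ a b j → a ℕ.+ b ≡ j ℕ.+ j → suc a ℕ.+ suc b ≡ suc j ℕ.+ suc j
    even-step₁ a b j e = trans (+-suc (suc a) b) (trans (cong (λ n → suc (suc n)) e) (sym (+-suc (suc j) j)))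

    even-step₂ : ∀ a b j → a ℕ.+ b ≡ j ℕ.+ j → suc (suc a) ℕ.+ b ≡ suc j ℕ.+ suc j
    even-step₂ a b j e = trans (cong (λ n → suc (suc n)) e) (sym (+-suc (suc j) j))

  -- Induction on (a bound for) the size of P: peel off a fixed point or a 2-cycle.
  parity-below : ∀ fuel N f P → count P N ≤ fuel → InvolutionOn N f P → Even (count P N ℕ.+ count (FixedBy f P) N)
  parity-below fuel N f P bound inv with empty-or-member P N
  ... | inj₁ empty = 0 , cong₂ ℕ._+_ (count-empty P N empty)
                           (count-empty (FixedBy f P) N (λ x x<N t → empty x x<N (proj₁ (Equivalence.to T-∧ t))))
  ... | inj₂ (a , a<N , Pa) = peel fuel bound (f a ≟ a)
    where
    open InvolutionOn inv
    P-drop : count P N ≡ suc (count (remove a P) N)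
    P-drop = count-remove a P N a<N Pa
    peel : ∀ fuel → count P N ≤ fuel → Dec (f a ≡ a) → Even (count P N ℕ.+ count (FixedBy f P) N)
    peel zero bound _ = contradiction (subst (_≤ 0) P-drop bound) λ ()
    peel (suc fuel) bound (yes fa≡a) =
      let (j , e) = parity-below fuel N f (remove a P) (≤-pred (subst (_≤ suc fuel) P-drop bound)) (restrict-fixed inv fa≡a)
      in suc j , subst₂ (λ m n → m ℕ.+ n ≡ suc j ℕ.+ suc j) (sym P-drop) (sym F-drop) (even-step₁ (count (remove a P) N) (count (FixedBy f (remove a P)) N) j e)
      where
      F-drop : count (FixedBy f P) N ≡ suc (count (FixedBy f (remove a P)) N)
      F-drop = trans (count-remove a (FixedBy f P) N a<N (fixed-member f P a Pa fa≡a))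
                     (cong suc (sym (count-ext _ _ N (λ x _ → FixedBy-remove f a P x))))
    peel (suc fuel) bound (no fa≢a) =
      let (j , e) = parity-below fuel N f P'' (≤-pred (≤-trans (n≤1+n _) (subst (_≤ suc fuel) P-drop₂ bound))) (restrict-pair inv a<N Pa)
      in suc j , subst₂ (λ m n → m ℕ.+ n ≡ suc j ℕ.+ suc j) (sym P-drop₂) F-same (even-step₂ (count P'' N) (count (FixedBy f P'') N) j e)
      where
      P'' = remove (f a) (remove a P)
      P-drop₂ : count P N ≡ suc (suc (count P'' N))
      P-drop₂ = trans P-drop (cong suc (count-remove (f a) (remove a P) N (bounded a a<N Pa)
                  (remove-member a P (f a) (closed a a<N Pa) fa≢a)))
      ffa≢fa : f (f a) ≢ f a
      ffa≢fa ffa≡fa = fa≢a (trans (sym ffa≡fa) (involutive a a<N Pa))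
      F-same : count (FixedBy f P'') N ≡ count (FixedBy f P) N
      F-same = count-ext _ _ N λ x _ →
        trans (FixedBy-remove-nonfixed f (f a) (remove a P) x ffa≢fa) (FixedBy-remove-nonfixed f a P x fa≢a)

  fixed-point-parity : ∀ N f P → InvolutionOn N f P → Even (count P N ℕ.+ count (FixedBy f P) N)
  fixed-point-parity N f P = parity-below (count P N) N f P ≤-refl

-- The largest y < N with a decidable property Q, or 0 if there is none.
search : {Q : ℕ → Set} → (∀ y → Dec (Q y)) → ℕ → ℕ
search Q? zero = 0
search Q? (suc N) with Q? N
... | yes _ = N
... | no _ = search Q? N

search-finds : ∀ {Q : ℕ → Set} (Q? : ∀ y → Dec (Q y)) N y → y < N → Q y → Q (search Q? N)
search-finds Q? (suc N) y y<1+N Qy with Q? N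
... | yes QN = QN
... | no ¬QN with m<1+n⇒m<n∨m≡n y<1+N
...   | inj₁ y<N = search-finds Q? N y y<N Qy
...   | inj₂ refl = contradiction Qy ¬QN

-- The quadratic character of -1.  For p = 1 + 2m every nonzero residue is
-- ±y for a unique y ∈ {1,…,m}; pairing x ∈ {1,…,m} with the y such that
-- xy ≡ ±1 is an involution whose fixed points are the x with x² ≡ ±1,
-- namely x = 1 and, exactly when -1 is a square, one further point.
-- Fixed-point parity then forces m + 1, respectively m + 2, to be even.
module MinusOne (p : ℕ) (p-prime : Prime p) (m : ℕ) (p≡1+2m : p ≡ suc (m ℕ.+ m)) (1≤m : 1 ≤ m) where
  open Residues p p-prime
  open FixedPointParity

  -- Representatives of the nonzero residues up to sign.
  Small : ℕ → Set
  Small y = 1 ≤ y × y ≤ m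

  private
    2m<p : m ℕ.+ m < p
    2m<p = subst (m ℕ.+ m <_) (sym p≡1+2m) ≤-refl

    sum<p : ∀ {y y'} → Small y → Small y' → y ℕ.+ y' < p
    sum<p (_ , y≤m) (_ , y'≤m) = ℕP.≤-<-trans (ℕP.+-mono-≤ y≤m y'≤m) 2m<p

  small-unit : ∀ {y} → Small y → ¬ Zero (+ y)
  small-unit {y} (1≤y , y≤m) = small-nonzero y 1≤y (ℕP.≤-<-trans (ℕP.≤-trans y≤m (ℕP.m≤m+n m m)) 2m<p)

  -- Small numbers are pairwise incongruent and never opposite, because
  -- their sums and differences are smaller than p in absolute value.
  small-injective : ∀ {y y'} → Small y → Small y' → Zero (+ y - + y') → y ≡ y'
  small-injective {y} {y'} sy sy' z = ℤP.+-injective (ℤP.i-j≡0⇒i≡j (+ y) (+ y')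
    (small-zero (+ y - + y') (ℕP.≤-<-trans (ℤP.∣i-j∣≤∣i∣+∣j∣ (+ y) (+ y')) (sum<p sy sy')) z))

  small-not-opposite : ∀ {y y'} → Small y → Small y' → ¬ Zero (+ y + + y')
  small-not-opposite {y} {y'} sy@(1≤y , _) sy' z =
    small-nonzero (y ℕ.+ y') (ℕP.<-≤-trans 1≤y (ℕP.m≤m+n y y')) (sum<p sy sy') (subst Zero (sym (ℤP.pos-+ y y')) z)

  -- Hence y² ≡ y'² forces y ≡ y' for small y, y' (factor (y - y')(y + y')).
  square-root-unique : ∀ {y y'} → Small y → Small y' → Zero (+ y * + y - + y' * + y') → y ≡ y'
  square-root-unique {y} {y'} sy sy' z =
    [ small-injective sy sy' , (λ zsum → contradiction zsum (small-not-opposite sy sy')) ]′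
      (euclid (+ y - + y') (+ y + + y') (subst Zero (factor (+ y) (+ y')) z))
    where
    factor : ∀ a b → a * a - b * b ≡ (a - b) * (a + b)
    factor = solve-∀

  -- Every nonzero residue is ± a small one: reduce mod p, and replace a
  -- remainder r > m by p - r.
  representative : ∀ a → ¬ Zero a → ∃[ y ] (Small y × (Zero (a - + y) ⊎ Zero (a + + y)))
  representative a na = from-remainder (a %ℕ p) (a /ℕ p) (a≡a%ℕn+[a/ℕn]*n a p) (n%ℕd<d a p)
    where
    drop-remainder : ∀ r q p → (r + q * p) - r ≡ q * p
    drop-remainder = solve-∀
    complete-remainder : ∀ r q p → (r + q * p) + (p - r) ≡ (q + + 1) * p
    complete-remainder = solve-∀
    from-remainder : ∀ r q → a ≡ + r + q * + p → r < p → ∃[ y ] (Small y × (Zero (a - + y) ⊎ Zero (a + + y)))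
    from-remainder zero q a≡qp _ = contradiction (combination₁ q (+ p) (trans a≡qp (ℤP.+-identityˡ _)) zero-p) na
    from-remainder (suc r) q a≡r+qp r<p with suc r ℕ.≤? m
    ... | yes r≤m = suc r , (s≤s z≤n , r≤m) ,
      inj₁ (combination₁ q (+ p) (trans (cong (_- + suc r) a≡r+qp) (drop-remainder (+ suc r) q (+ p))) zero-p)
    ... | no r≰m = p ℕ.∸ suc r , (ℕP.m<n⇒0<n∸m r<p , p-r≤m) ,
      inj₂ (combination₁ (q + + 1) (+ p) (trans (cong₂ _+_ a≡r+qp p-r≡p-r) (complete-remainder (+ suc r) q (+ p))) zero-p)
      where
      p-r≤m : p ℕ.∸ suc r ≤ m
      p-r≤m = ℕP.≤-trans (ℕP.∸-monoʳ-≤ p (ℕP.≰⇒> r≰m))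
                (ℕP.≤-reflexive (trans (cong (ℕ._∸ suc m) p≡1+2m) (ℕP.m+n∸m≡n m m)))
      p-r≡p-r : + (p ℕ.∸ suc r) ≡ + p - + suc r
      p-r≡p-r = trans (sym (ℤP.⊖-≥ (ℕP.<⇒≤ r<p))) (sym (ℤP.m-n≡m⊖n p (suc r)))

  Partner : ℕ → ℕ → Set
  Partner x y = Small y × (Zero (+ x * + y - + 1) ⊎ Zero (+ x * + y + + 1))

  partner? : ∀ x y → Dec (Partner x y)
  partner? x y = ((1 ℕ.≤? y) ×-dec (y ℕ.≤? m)) ×-dec (zero? _ ⊎-dec zero? _)

  -- The partner of x is the representative of x⁻¹.
  partner-exists : ∀ {x} → Small x → ∃[ y ] Partner x y
  partner-exists {x} sx =
    let (u , inv) = inverse (+ x) (small-unit sx)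
        (y , sy , u≡±y) = representative u (invertible-nonzero inv)
    in y , sy , Data.Sum.map
         (λ u≡y → combination₂ (+ 1) (u * + x - + 1) (- + x) (u - + y) (via-minus (+ x) (+ y) u) inv u≡y)
         (λ u≡-y → combination₂ (- + 1) (u * + x - + 1) (+ x) (u + + y) (via-plus (+ x) (+ y) u) inv u≡-y) u≡±y
    where
    via-minus : ∀ x y u → x * y - + 1 ≡ (+ 1) * (u * x - + 1) + (- x) * (u - y)
    via-minus = solve-∀
    via-plus : ∀ x y u → x * y + + 1 ≡ (- + 1) * (u * x - + 1) + x * (u + y)
    via-plus = solve-∀

  -- Partners satisfy (xy)² ≡ 1, so x² y² ≡ x² y'² and hence y ≡ y'.
  partner-square : ∀ x y → Partner x y → Zero ((+ x * + y) * (+ x * + y) - + 1)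
  partner-square x y (_ , inj₁ z) = combination₁ (+ x * + y + + 1) _ (difference (+ x * + y)) z
    where
    difference : ∀ t → t * t - + 1 ≡ (t + + 1) * (t - + 1)
    difference = solve-∀
  partner-square x y (_ , inj₂ z) = combination₁ (+ x * + y - + 1) _ (difference (+ x * + y)) z
    where
    difference : ∀ t → t * t - + 1 ≡ (t - + 1) * (t + + 1)
    difference = solve-∀

  partner-unique : ∀ {x y y'} → Small x → Partner x y → Partner x y' → y ≡ y'
  partner-unique {x} {y} {y'} sx py py' = square-root-unique (proj₁ py) (proj₁ py')
    (cancelˡ (nonzero-* (small-unit sx) (small-unit sx))
      (combination₂ (+ 1) _ (- + 1) _ (scaled-difference (+ x) (+ y) (+ y')) (partner-square x y py) (partner-square x y' py')))
    where
    scaled-difference : ∀ x y y' → (x * x) * (y * y - y' * y') ≡ (+ 1) * ((x * y) * (x * y) - + 1) + (- + 1) * ((x * y') * (x * y') - + 1)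
    scaled-difference = solve-∀

  partner-sym : ∀ {x y} → Small x → Partner x y → Partner y x
  partner-sym {x} {y} sx (_ , z) = sx , Data.Sum.map (subst (λ t → Zero (t - + 1)) (ℤP.*-comm (+ x) (+ y)))
                                                     (subst (λ t → Zero (t + + 1)) (ℤP.*-comm (+ x) (+ y))) z

  -- The partner function, kept abstract: only its specification matters.
  abstract
    partner : ℕ → ℕ
    partner x = search (partner? x) (suc m)

    partner-spec : ∀ {x} → Small x → Partner x (partner x)
    partner-spec {x} sx = let (y , py) = partner-exists sx in search-finds (partner? x) (suc m) y (s≤s (proj₂ (proj₁ py))) py

  partner-involutive : ∀ {x} → Small x → partner (partner x) ≡ x
  partner-involutive sx = let px = partner-spec sx in partner-unique (proj₁ px) (partner-spec (proj₁ px)) (partner-sym sx px)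

  -- Below m + 1, the small numbers are the positive ones.
  positive : Subset
  positive zero = false
  positive (suc _) = true

  positive⇒small : ∀ {x} → x < suc m → T (positive x) → Small x
  positive⇒small {suc x} x<1+m _ = s≤s z≤n , ≤-pred x<1+m

  small⇒positive : ∀ {x} → Small x → T (positive x)
  small⇒positive {suc x} _ = _

  count-positive : ∀ n → count positive (suc n) ≡ n
  count-positive zero = refl
  count-positive (suc n) = cong suc (count-positive n)

  partner-involution : InvolutionOn (suc m) partner positive
  partner-involution = record
    { bounded = λ x x<1+m t → s≤s (proj₂ (proj₁ (partner-spec (positive⇒small x<1+m t))))
    ; closed = λ x x<1+m t → small⇒positive (proj₁ (partner-spec (positive⇒small x<1+m t)))
    ; involutive = λ x x<1+m t → partner-involutive (positive⇒small x<1+m t)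
    }

  Fixed : Subset
  Fixed = FixedBy partner positive

  fixed⇒self-partner : ∀ {x} → x < suc m → T (Fixed x) → Small x × Partner x x
  fixed⇒self-partner {x} x<1+m t =
    let (pos , fixed) = Equivalence.to T-∧ t
        sx = positive⇒small x<1+m pos
    in sx , subst (Partner x) (≡ᵇ⇒≡ (partner x) x fixed) (partner-spec sx)

  self-partner⇒fixed : ∀ {x} → Small x → Partner x x → T (Fixed x)
  self-partner⇒fixed {x} sx px =
    Equivalence.from T-∧ (small⇒positive sx , ≡⇒≡ᵇ (partner x) x (partner-unique sx (partner-spec sx) px))

  one-small : Small 1
  one-small = ≤-refl , 1≤m

  one-fixed : T (Fixed 1)
  one-fixed = self-partner⇒fixed one-small (one-small , inj₁ zero-0)

  self-partner-cases : ∀ {x} → Small x → Partner x x → x ≡ 1 ⊎ Zero (+ x * + x + + 1)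
  self-partner-cases sx (_ , inj₁ z) = inj₁ (square-root-unique sx one-small z)
  self-partner-cases sx (_ , inj₂ z) = inj₂ z

  same-root : ∀ {x s} → Small x → Small s → Zero (+ x * + x + + 1) → Zero (+ s * + s + + 1) → x ≡ s
  same-root {x} {s} sx ss zx zs = square-root-unique sx ss (combination₂ (+ 1) _ (- + 1) _ (difference (+ x) (+ s)) zx zs)
    where
    difference : ∀ x s → x * x - s * s ≡ (+ 1) * (x * x + + 1) + (- + 1) * (s * s + + 1)
    difference = solve-∀

  fixed-count-without-root : (∀ s → ¬ Zero (s * s + + 1)) → count Fixed (suc m) ≡ 1
  fixed-count-without-root no-root =
    trans (count-remove 1 Fixed (suc m) (s≤s 1≤m) one-fixed) (cong suc (count-empty (remove 1 Fixed) (suc m) only-one))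
    where
    only-one : ∀ x → x < suc m → ¬ T (remove 1 Fixed x)
    only-one x x<1+m t =
      let (fx , x≢1) = member-remove 1 Fixed x t
          (sx , px) = fixed⇒self-partner x<1+m fx
      in [ x≢1 , no-root (+ x) ]′ (self-partner-cases sx px)

  fixed-count-with-root : ∀ {s} → Small s → Zero (+ s * + s + + 1) → count Fixed (suc m) ≡ 2
  fixed-count-with-root {s} ss zs =
    trans (count-remove 1 Fixed (suc m) (s≤s 1≤m) one-fixed)
      (cong suc (trans (count-remove s (remove 1 Fixed) (suc m) (s≤s (proj₂ ss)) s-fixed)
        (cong suc (count-empty (remove s (remove 1 Fixed)) (suc m) only-two))))
    where
    s≢1 : s ≢ 1
    s≢1 refl = small-not-opposite one-small one-small zs
    s-fixed : T (remove 1 Fixed s)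
    s-fixed = remove-member 1 Fixed s (self-partner⇒fixed ss (ss , inj₂ zs)) s≢1
    only-two : ∀ x → x < suc m → ¬ T (remove s (remove 1 Fixed) x)
    only-two x x<1+m t =
      let (t' , x≢s) = member-remove s (remove 1 Fixed) x t
          (fx , x≢1) = member-remove 1 Fixed x t'
          (sx , px) = fixed⇒self-partner x<1+m fx
      in [ x≢1 , (λ zx → x≢s (same-root sx ss zx zs)) ]′ (self-partner-cases sx px)

  parity-without-root : (∀ s → ¬ Zero (s * s + + 1)) → Even (m ℕ.+ 1)
  parity-without-root no-root =
    subst Even (cong₂ ℕ._+_ (count-positive m) (fixed-count-without-root no-root))
      (fixed-point-parity (suc m) partner positive partner-involution)

  -- A root of s² + 1 can be taken small: replace s by its representative ±y.
  small-root : ∀ s → Zero (s * s + + 1) → ∃[ y ] (Small y × Zero (+ y * + y + + 1))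
  small-root s zs =
    let (y , sy , s≡±y) = representative s s-nonzero
    in y , sy , [ (λ z → combination₂ (+ 1) (s * s + + 1) (- (s + + y)) (s - + y) (minus s (+ y)) zs z)
                , (λ z → combination₂ (+ 1) (s * s + + 1) (- (s - + y)) (s + + y) (plus s (+ y)) zs z) ]′ s≡±y
    where
    s-nonzero : ¬ Zero s
    s-nonzero z = one-nonzero (combination₂ (+ 1) (s * s + + 1) (- s) s (one-as s) zs z)
      where
      one-as : ∀ s → + 1 ≡ (+ 1) * (s * s + + 1) + (- s) * s
      one-as = solve-∀
    minus : ∀ s y → y * y + + 1 ≡ (+ 1) * (s * s + + 1) + (- (s + y)) * (s - y)
    minus = solve-∀
    plus : ∀ s y → y * y + + 1 ≡ (+ 1) * (s * s + + 1) + (- (s - y)) * (s + y)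
    plus = solve-∀

  parity-with-root : ∀ s → Zero (s * s + + 1) → Even (m ℕ.+ 2)
  parity-with-root s zs =
    let (y , sy , zy) = small-root s zs
    in subst Even (cong₂ ℕ._+_ (count-positive m) (fixed-count-with-root sy zy))
         (fixed-point-parity (suc m) partner positive partner-involution)

-- Under the hypotheses of the theorem -c is not a square in GF(p): if
-- p ≡ 1 (mod 4) then -1 is a square and c is not, and if p ≡ 3 (mod 4)
-- then -1 is not a square and c is.  Hence the norm form y² + c z² is
-- anisotropic and no point of a conic O_k (k ≢ 0) has first coordinate 0.
module Anisotropy (p : ℕ) (p-prime : Prime p) (p≢2 : p ≢ 2) (c : ℤ) (c≢0 : ¬ IsZero p c)
                  (c-nonsquare : p % 4 ≡ 1 → ¬ IsSquare p c) (c-square : p % 4 ≡ 3 → IsSquare p c) where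
  open Residues p p-prime
  open FixedPointParity using (Even)
  open Similarity p p-prime c using (norm)

  private
    k : ℕ
    k = p ℕ./ 4

    p≡r+4k : p ≡ p % 4 ℕ.+ k ℕ.* 4
    p≡r+4k = ℕDM.m≡m%n+[m/n]*n p 4

    p-from-residue : ∀ {r} → p % 4 ≡ r → p ≡ r ℕ.+ k ℕ.* 4
    p-from-residue {r} e = trans p≡r+4k (cong (ℕ._+ k ℕ.* 4) e)

    2∤p : ¬ (2 ℕD.∣ p)
    2∤p 2∣p with prime⇒irreducible p-prime 2∣p
    ... | inj₂ 2≡p = p≢2 (sym 2≡p)

    odd-not-even : ∀ n → ¬ Even (suc (n ℕ.+ n))
    odd-not-even zero (zero , ())
    odd-not-even zero (suc j , 1≡j+j) with trans (ℕP.suc-injective 1≡j+j) (ℕP.+-suc j j)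
    ... | ()
    odd-not-even (suc n) (zero , ())
    odd-not-even (suc n) (suc j , e) = odd-not-even n (j ,
      ℕP.suc-injective (ℕP.suc-injective (trans (cong suc (sym (ℕP.+-suc (suc n) n))) (trans e (ℕP.+-suc (suc j) j)))))

  residue-mod-4 : p % 4 ≡ 1 ⊎ p % 4 ≡ 3
  residue-mod-4 = cases (p % 4) refl (ℕDM.m%n<n p 4)
    where
    even-0 : ∀ k → 0 ℕ.+ k ℕ.* 4 ≡ (k ℕ.* 2) ℕ.* 2
    even-0 = ℕSolver.solve-∀
    even-2 : ∀ k → 2 ℕ.+ k ℕ.* 4 ≡ (1 ℕ.+ k ℕ.* 2) ℕ.* 2
    even-2 = ℕSolver.solve-∀
    cases : ∀ r → p % 4 ≡ r → r < 4 → p % 4 ≡ 1 ⊎ p % 4 ≡ 3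
    cases 0 e _ = ⊥-elim (2∤p (ℕD.divides (k ℕ.* 2) (trans (p-from-residue e) (even-0 k))))
    cases 1 e _ = inj₁ e
    cases 2 e _ = ⊥-elim (2∤p (ℕD.divides (1 ℕ.+ k ℕ.* 2) (trans (p-from-residue e) (even-2 k))))
    cases 3 e _ = inj₂ e
    cases (suc (suc (suc (suc r)))) _ (s≤s (s≤s (s≤s (s≤s ()))))

  minus-one-square : p % 4 ≡ 1 → ¬ (∀ s → ¬ Zero (s * s + + 1))
  minus-one-square r no-root = case-on k refl
    where
    shape : ∀ k → 1 ℕ.+ k ℕ.* 4 ≡ suc ((k ℕ.+ k) ℕ.+ (k ℕ.+ k))
    shape = ℕSolver.solve-∀
    case-on : ∀ k' → k ≡ k' → ⊥
    case-on zero k≡0 = ℕP.<-irrefl (sym (trans (p-from-residue r) (cong (λ k → 1 ℕ.+ k ℕ.* 4) k≡0)))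
                         (ℕ.nonTrivial⇒n>1 p {{prime⇒nonTrivial p-prime}})
    case-on (suc k') k≡1+k' = odd-not-even k
      (subst Even (ℕP.+-comm (k ℕ.+ k) 1)
        (MinusOne.parity-without-root p p-prime (k ℕ.+ k) (trans (p-from-residue r) (shape k)) 1≤2k no-root))
      where
      1≤2k : 1 ≤ k ℕ.+ k
      1≤2k = subst (λ k → 1 ≤ k ℕ.+ k) (sym k≡1+k') (s≤s z≤n)

  minus-one-nonsquare : p % 4 ≡ 3 → ∀ s → ¬ Zero (s * s + + 1)
  minus-one-nonsquare r s zs = odd-not-even (suc k)
    (subst Even (last-step k) (MinusOne.parity-with-root p p-prime (suc (k ℕ.+ k)) (trans (p-from-residue r) (shape k)) (s≤s z≤n) s zs))
    where
    shape : ∀ k → 3 ℕ.+ k ℕ.* 4 ≡ suc (suc (k ℕ.+ k) ℕ.+ suc (k ℕ.+ k))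
    shape = ℕSolver.solve-∀
    last-step : ∀ k → suc (k ℕ.+ k) ℕ.+ 2 ≡ suc (suc k ℕ.+ suc k)
    last-step = ℕSolver.solve-∀

  minus-c-nonsquare : ∀ u → ¬ Zero (u * u + c)
  minus-c-nonsquare u zu with residue-mod-4
  ... | inj₁ r = minus-one-square r λ s zs →
    c-nonsquare r (s * u , toCong ((s * u) * (s * u)) c (combination₂ (s * s) _ (- c) _ (identity s u c) zu zs))
    where
    identity : ∀ s u c → (s * u) * (s * u) - c ≡ (s * s) * (u * u + c) + (- c) * (s * s + + 1)
    identity = solve-∀
  ... | inj₂ r =
    let (t , t²≡c) = c-square r
        zt = fromCong (t * t) c t²≡c
        (v , inv) = inverse t (t-nonzero t zt)
        -- (u t⁻¹)² ≡ -c t⁻² ≡ -1, exhibited as a combination of the three zeros.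
        zsum = combination₂ (v * v) (u * u + c) (v * v) (t * t - c) refl zu zt
    in minus-one-nonsquare r (u * v)
         (combination₂ (+ 1) ((v * v) * (u * u + c) + (v * v) * (t * t - c)) (- (v * t + + 1)) (v * t - + 1)
           (identity u v t c) zsum inv)
    where
    t-nonzero : ∀ t → Zero (t * t - c) → ¬ Zero t
    t-nonzero t zt z = ¬IsZero⇒¬Zero c c≢0 (combination₂ t t (- + 1) (t * t - c) (c-as t c) z zt)
      where
      c-as : ∀ t c → c ≡ t * t + (- + 1) * (t * t - c)
      c-as = solve-∀
    identity : ∀ u v t c → (u * v) * (u * v) + + 1
                           ≡ (+ 1) * ((v * v) * (u * u + c) + (v * v) * (t * t - c)) + (- (v * t + + 1)) * (v * t - + 1)
    identity = solve-∀

  norm-anisotropic : ∀ y z → Zero (norm y z) → Zero y × Zero z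
  norm-anisotropic y z zn with zero? z
  ... | yes zz = square-zero y (combination₂ (+ 1) _ (- (c * z)) z (y²-as y z c) zn zz) , zz
    where
    y²-as : ∀ y z c → y * y ≡ (+ 1) * (y * y + c * (z * z)) + (- (c * z)) * z
    y²-as = solve-∀
  ... | no nz = let (w , inv) = inverse z nz in ⊥-elim (
    minus-c-nonsquare (y * w) (combination₂ (w * w) _ (- c * (w * z + + 1)) _ (scaled y z w c) zn inv))
    where
    scaled : ∀ y z w c → (y * w) * (y * w) + c ≡ (w * w) * (y * y + c * (z * z)) + (- c * (w * z + + 1)) * (w * z - + 1)
    scaled = solve-∀

  first-coordinate-nonzero : ∀ k P → ¬ Zero k → IsProj p P → OnConic p c k P → ¬ Zero (first P)
  first-coordinate-nonzero k (x , y , z) nk proj on zx =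
    let (zy , zz) = norm-anisotropic y z (cancelˡ nk (combination₂ (+ 1) (x * x + k * (y * y) + (c * k) * (z * z)) (- x) x
                                                        (k-norm x y z k c) (fromIsZero on) zx))
    in IsProj⇒¬AllZero proj (zx , zy , zz)
    where
    k-norm : ∀ x y z k c → k * (y * y + c * (z * z)) ≡ (+ 1) * (x * x + k * (y * y) + (c * k) * (z * z)) + (- x) * x
    k-norm = solve-∀

-- Move the given polygon by the admissible σ sending P to Q: the image is
-- again a Poncelet polygon, and its vertex σ(Bᵢ) ≡ σ(P) ≡ Q.
mainTheorem1 : (p : ℕ) → Prime p → p ≢ 2 →
    (c : ℤ) → ¬ IsZero p c →
    (p % 4 ≡ 1 → ¬ IsSquare p c) →
    (p % 4 ≡ 3 → IsSquare p c) →
    (α β : ℕ) → 1 ≤ α → α < p → 1 ≤ β → β < p → α ≢ β →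
    (n : ℕ) → 3 ≤ n →
    (P : Triple) → IsProj p P → OnConic p c (+ β) P →
    HasPolygonWithVertex p c (+ α) (+ β) n P →
    (Q : Triple) → IsProj p Q → OnConic p c (+ β) Q →
    HasPolygonWithVertex p c (+ α) (+ β) n Q
mainTheorem1 p p-prime p≢2 c c≢0 c-nonsquare c-square α β _ _ 1≤β β<p _ n _
             P projP onP (B , polygon , i , Bᵢ≡P) Q projQ onQ =
  let (s , a , b , adm , σP≡Q) = σ-transitive (+ β) P Q (x-nonzero P projP onP) (x-nonzero Q projQ onQ) onP onQ
  in (λ j → σ s a b (B j)) , σ-polygon (+ α) (+ β) n B adm polygon , i ,
     samePt-trans (σ s a b (B i)) (σ s a b P) Q (σ-samePt s a b (B i) P Bᵢ≡P) σP≡Q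
  where
  open Residues p p-prime
  open Similarity p p-prime c
  open Anisotropy p p-prime p≢2 c c≢0 c-nonsquare c-square
  x-nonzero : ∀ T → IsProj p T → OnConic p c (+ β) T → ¬ Zero (first T)
  x-nonzero T = first-coordinate-nonzero (+ β) T (small-nonzero β 1≤β β<p)
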